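{- Let $T$ be a finite set of tense formulas with $\top,\bot\in T$. For any $X,Y\subseteq FS(T^\circ)$: $\Diamond_cC(X)\subseteq C(Y)$ if and only if $C(X)\subseteq\blacksquare C(Y)$.
   Context: Tense formulas are built from a countable set of propositional variables using $\bot,\top$, unary $\neg,\Diamond,\blacksquare$ and binary $\wedge,\vee$; $\Diamond^0\varphi=\varphi$, $\Diamond^{k+1}\varphi=\Diamond\Diamond^k\varphi$. Formula structures: $\langle\varphi\rangle^n$ is the formal expression obtained by applying a unary structural operator $\langle\cdot\rangle$ $n$ times to the formula $\varphi$ ($\langle\varphi\rangle^0=\varphi$); if $\Gamma=\langle\varphi\rangle^n$ then $\langle\Gamma\rangle=\langle\varphi\rangle^{n+1}$. For a set of formulas $X$, $FS(X)=\{\langle\varphi\rangle^n\mid\varphi\in X,\ n\geq0\}$. The calculus $\mathsf{G}$ has axioms (arbitrary formulas, $n\geq0$): $\varphi\Rightarrow\varphi$; $\varphi\wedge(\psi\vee\chi)\Rightarrow(\varphi\wedge\psi)\vee(\varphi\wedge\chi)$; $\varphi\Rightarrow\top$; $\langle\bot\rangle^n\Rightarrow\psi$; $\varphi\wedge\neg\varphi\Rightarrow\bot$; $\top\Rightarrow\varphi\vee\neg\varphi$; $\Diamond^3\varphi\Rightarrow\Diamond^2\varphi$; and rules (arbitrary $n\geq0$): from $\langle\varphi_i\rangle^n\Rightarrow\psi$ infer $\langle\varphi_1\wedge\varphi_2\rangle^n\Rightarrow\psi$ ($i=1,2$); from $\Gamma\Rightarrow\psi_1$, $\Gamma\Rightarrow\psi_2$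 infer $\Gamma\Rightarrow\psi_1\wedge\psi_2$; from $\langle\varphi_1\rangle^n\Rightarrow\psi$, $\langle\varphi_2\rangle^n\Rightarrow\psi$ infer $\langle\varphi_1\vee\varphi_2\rangle^n\Rightarrow\psi$; from $\Gamma\Rightarrow\psi_i$ infer $\Gamma\Rightarrow\psi_1\vee\psi_2$; from $\langle\varphi\rangle^{n+1}\Rightarrow\psi$ infer $\langle\Diamond\varphi\rangle^n\Rightarrow\psi$; from $\Gamma\Rightarrow\psi$ infer $\langle\Gamma\rangle\Rightarrow\Diamond\psi$; from $\langle\varphi\rangle^n\Rightarrow\psi$ infer $\langle\blacksquare\varphi\rangle^{n+1}\Rightarrow\psi$; from $\langle\Gamma\rangle\Rightarrow\psi$ infer $\Gamma\Rightarrow\blacksquare\psi$; from $\Gamma\Rightarrow\varphi$ and $\langle\varphi\rangle^n\Rightarrow\psi$ infer $\langle\Gamma\rangle^n\Rightarrow\psi$ (Cut). A derivation is a finite tree of sequents each node of which is an axiom instance or obtained from its children by a rule. $T^\Diamond=\{\Diamond^k\varphi\mid\varphi\in T,\ 0\leq k\leq 3\}$; $T^\circ$ is the smallest set containing $T^\Diamond$ closed under $\neg,\wedge,\vee$; $T^\bullet=T^\circ\setminus T^\Diamond$. $\mathsf{G}\vdash\Gamma\Rightarrow_{T^\circ}\psi$ means there is a derivation of $\Gamma\Rightarrow\psi$ in $\mathsf{G}$ all of whose formulas lie in $T^\circ$. For $\varphi\in T^\circ$: $G(\varphi)=\{\langle\chi\rangle^n\in FS(T^\Diamond)\mid\mathsf{G}\vdash\langle\chi\rangle^n\Rightarrow_{T^\circ}\varphi\}$,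 $[\![\varphi]\!]=G(\varphi)\cup FS(T^\bullet)$, $[\![T^\circ]\!]=\{[\![\varphi]\!]\mid\varphi\in T^\circ\}$. For $X\subseteq FS(T^\circ)$: $C(X)=\bigcap\{[\![\varphi]\!]\mid X\subseteq[\![\varphi]\!]\in[\![T^\circ]\!]\}$, $\Diamond X=\{\langle\Gamma\rangle\mid\Gamma\in X\}$, $\blacksquare X=\{\Gamma\in FS(T^\circ)\mid\langle\Gamma\rangle\in X\}$, and $\Diamond_cX=C(\Diamond X)$. -}

module Defs where

open import Data.Nat using (ℕ; zero; suc; _+_; _≤_)
open import Data.Product using (Σ; ∃; _×_; _,_)
open import Data.Sum using (_⊎_)
open import Data.List using (List)
open import Data.List.Membership.Propositional using (_∈_)
open import Relation.Nullary using (¬_)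
open import Relation.Binary.PropositionalEquality using (_≡_)

infixr 6 _and_
infixr 5 _or_

data Fm : Set where
  var  : ℕ → Fm
  bot  : Fm
  top  : Fm
  neg  : Fm → Fm
  dia  : Fm → Fm
  bbox : Fm → Fm
  _and_ : Fm → Fm → Fm
  _or_  : Fm → Fm → Fm

diaN : ℕ → Fm → Fm
diaN zero    φ = φ
diaN (suc k) φ = dia (diaN k φ)

record FStr : Set where
  constructor ⟨_⟩^_
  field
    fm    : Fm
    depth : ℕ
open FStr public

wrap : FStr → FStr
wrap (⟨ φ ⟩^ n) = ⟨ φ ⟩^ suc n

wrapN : ℕ → FStr → FStr
wrapN n (⟨ φ ⟩^ m) = ⟨ φ ⟩^ (n + m)

fs : Fm → FStr
fs φ = ⟨ φ ⟩^ 0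

-- The calculus G, restricted to derivations all of whose formulas
-- satisfy P.  Every node of a derivation is the conclusion of exactly one
-- constructor, and each constructor demands that the formulas of its
-- conclusion sequent satisfy P.

data Der (P : Fm → Set) : FStr → Fm → Set where
  ax-id   : ∀ {φ} → P φ → Der P (fs φ) φ
  ax-dist : ∀ {φ ψ χ} → P (φ and (ψ or χ)) → P ((φ and ψ) or (φ and χ)) →
            Der P (fs (φ and (ψ or χ))) ((φ and ψ) or (φ and χ))
  ax-top  : ∀ {φ} → P φ → P top → Der P (fs φ) top
  ax-bot  : ∀ {n ψ} → P bot → P ψ → Der P (⟨ bot ⟩^ n) ψ
  ax-neg1 : ∀ {φ} → P (φ and neg φ) → P bot → Der P (fs (φ and neg φ)) bot
  ax-neg2 : ∀ {φ} → P top → P (φ or neg φ) → Der P (fs top) (φ or neg φ)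
  ax-dia  : ∀ {φ} → P (diaN 3 φ) → P (diaN 2 φ) → Der P (fs (diaN 3 φ)) (diaN 2 φ)
  andL₁   : ∀ {n φ₁ φ₂ ψ} → P (φ₁ and φ₂) → P ψ →
            Der P (⟨ φ₁ ⟩^ n) ψ → Der P (⟨ φ₁ and φ₂ ⟩^ n) ψ
  andL₂   : ∀ {n φ₁ φ₂ ψ} → P (φ₁ and φ₂) → P ψ →
            Der P (⟨ φ₂ ⟩^ n) ψ → Der P (⟨ φ₁ and φ₂ ⟩^ n) ψ
  andR    : ∀ {Γ ψ₁ ψ₂} → P (fm Γ) → P (ψ₁ and ψ₂) →
            Der P Γ ψ₁ → Der P Γ ψ₂ → Der P Γ (ψ₁ and ψ₂)
  orL     : ∀ {n φ₁ φ₂ ψ} → P (φ₁ or φ₂) → P ψ →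
            Der P (⟨ φ₁ ⟩^ n) ψ → Der P (⟨ φ₂ ⟩^ n) ψ → Der P (⟨ φ₁ or φ₂ ⟩^ n) ψ
  orR₁    : ∀ {Γ ψ₁ ψ₂} → P (fm Γ) → P (ψ₁ or ψ₂) →
            Der P Γ ψ₁ → Der P Γ (ψ₁ or ψ₂)
  orR₂    : ∀ {Γ ψ₁ ψ₂} → P (fm Γ) → P (ψ₁ or ψ₂) →
            Der P Γ ψ₂ → Der P Γ (ψ₁ or ψ₂)
  diaL    : ∀ {n φ ψ} → P (dia φ) → P ψ →
            Der P (⟨ φ ⟩^ suc n) ψ → Der P (⟨ dia φ ⟩^ n) ψ
  diaR    : ∀ {Γ ψ} → P (fm Γ) → P (dia ψ) →
            Der P Γ ψ → Der P (wrap Γ) (dia ψ)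
  boxL    : ∀ {n φ ψ} → P (bbox φ) → P ψ →
            Der P (⟨ φ ⟩^ n) ψ → Der P (⟨ bbox φ ⟩^ suc n) ψ
  boxR    : ∀ {Γ ψ} → P (fm Γ) → P (bbox ψ) →
            Der P (wrap Γ) ψ → Der P Γ (bbox ψ)
  cut     : ∀ {n Γ φ ψ} → P (fm Γ) → P ψ →
            Der P Γ φ → Der P (⟨ φ ⟩^ n) ψ → Der P (wrapN n Γ) ψ

InTD : List Fm → Fm → Set
InTD T ψ = Σ Fm λ φ → φ ∈ T × Σ ℕ λ k → k ≤ 3 × ψ ≡ diaN k φ

data InTC (T : List Fm) : Fm → Set where
  base  : ∀ {ψ} → InTD T ψ → InTC T ψ
  negC  : ∀ {ψ} → InTC T ψ → InTC T (neg ψ)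
  andC  : ∀ {ψ χ} → InTC T ψ → InTC T χ → InTC T (ψ and χ)
  orC   : ∀ {ψ χ} → InTC T ψ → InTC T χ → InTC T (ψ or χ)

InTB : List Fm → Fm → Set
InTB T ψ = InTC T ψ × ¬ InTD T ψ

FSet : Set₁
FSet = FStr → Set

_⊆_ : FSet → FSet → Set
X ⊆ Y = ∀ Γ → X Γ → Y Γ

InFS-TC : List Fm → FSet → Set
InFS-TC T X = ∀ Γ → X Γ → InTC T (fm Γ)

Gset : List Fm → Fm → FSet
Gset T φ Γ = InTD T (fm Γ) × Der (InTC T) Γ φ

⟦_⟧ : List Fm → Fm → FSet
⟦ T ⟧ φ Γ = Gset T φ Γ ⊎ InTB T (fm Γ)

Cl : List Fm → FSet → FSet
Cl T X Γ = ∀ φ → InTC T φ → X ⊆ ⟦ T ⟧ φ → ⟦ T ⟧ φ Γ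

DiaS : FSet → FSet
DiaS X Δ = Σ FStr λ Γ → X Γ × Δ ≡ wrap Γ

BoxS : List Fm → FSet → FSet
BoxS T X Γ = InTC T (fm Γ) × X (wrap Γ)

DiaC : List Fm → FSet → FSet
DiaC T X = Cl T (DiaS X)

module Submission where

-- The equivalence rests on two facts about the closure operator C.
--   * C is a closure operator: X ⊆ C(X), and A ⊆ C(Y) implies C(A) ⊆ C(Y).
--     This gives the backward direction and the second half of the forward
--     one, since ⟨Γ⟩ ∈ ◇C(X) ⊆ C(◇C(X)).
--   * C(X) ⊆ FS(T°) whenever X ⊆ FS(T°): the membership condition built into
--     ■.  It holds because [[⊤]] = FS(T°).  For structures over T^• this is
--     the definition; for ⟨ψ⟩^n with ψ ∈ T^◇ we derive ⟨ψ⟩^n ⇒ χ for some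
--     χ ∈ T^◇ (T^◇ is closed under ⟨·⟩ up to derivability, using the axiom
--     ◇³φ ⇒ ◇²φ to stay inside T°) and cut with χ ⇒ ⊤.  Splitting FS(T°)
--     into these two parts needs membership in T^◇ to be decidable, which
--     in turn needs decidable equality of formulas.

open import Defs
open import Data.List using (List)
open import Data.List.Membership.Propositional using (_∈_; find; lose)
open import Data.List.Relation.Unary.Any using (Any; any?)
open import Data.Nat using (ℕ; zero; suc; _≤_; _<_; z≤n; s≤s; s≤s⁻¹)
open import Data.Nat.Properties using (_≟_; ≤-refl; n≤1+n; m≤n⇒m<n∨m≡n; anyUpTo?)
open import Data.Product using (Σ; _×_; _,_; proj₂)
open import Data.Sum using (inj₁; inj₂)
open import Data.Tree.Binary using (Tree; leaf; node)
open import Function.Bundles using (_⇔_; mk⇔; mk↣)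
open import Relation.Binary.Definitions using (DecidableEquality)
open import Relation.Binary.PropositionalEquality using (_≡_; refl; cong; cong₂; sym; trans)
open import Relation.Nullary using (Dec; yes; no)
open import Relation.Nullary.Decidable using (map′; via-injection; _×-dec_)

tree-≟ : DecidableEquality (Tree ℕ ℕ)
tree-≟ (leaf m) (leaf n) = map′ (cong leaf) (λ { refl → refl }) (m ≟ n)
tree-≟ (leaf _) (node _ _ _) = no λ ()
tree-≟ (node _ _ _) (leaf _) = no λ ()
tree-≟ (node l m r) (node l′ n r′) =
  map′ (λ { (refl , refl , refl) → refl }) (λ { refl → refl , refl , refl })
       (tree-≟ l l′ ×-dec m ≟ n ×-dec tree-≟ r r′)

code : Fm → Tree ℕ ℕ
code (var n)   = leaf n
code bot       = node (leaf 0) 0 (leaf 0)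
code top       = node (leaf 0) 1 (leaf 0)
code (neg φ)   = node (code φ) 2 (leaf 0)
code (dia φ)   = node (code φ) 3 (leaf 0)
code (bbox φ)  = node (code φ) 4 (leaf 0)
code (φ and ψ) = node (code φ) 5 (code ψ)
code (φ or ψ)  = node (code φ) 6 (code ψ)

decode : Tree ℕ ℕ → Fm
decode (leaf n)     = var n
decode (node l 0 r) = bot
decode (node l 1 r) = top
decode (node l 2 r) = neg (decode l)
decode (node l 3 r) = dia (decode l)
decode (node l 4 r) = bbox (decode l)
decode (node l 5 r) = decode l and decode r
decode (node l _ r) = decode l or decode r

decode-code : ∀ φ → decode (code φ) ≡ φ
decode-code (var n)   = refl
decode-code bot       = refl
decode-code top       = refl
decode-code (neg φ)   = cong neg (decode-code φ)
decode-code (dia φ)   = cong dia (decode-code φ)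
decode-code (bbox φ)  = cong bbox (decode-code φ)
decode-code (φ and ψ) = cong₂ _and_ (decode-code φ) (decode-code ψ)
decode-code (φ or ψ)  = cong₂ _or_ (decode-code φ) (decode-code ψ)

code-injective : ∀ {φ ψ} → code φ ≡ code ψ → φ ≡ ψ
code-injective {φ} {ψ} eq =
  trans (sym (decode-code φ)) (trans (cong decode eq) (decode-code ψ))

_≟F_ : DecidableEquality Fm
_≟F_ = via-injection (mk↣ code-injective) tree-≟

InTD? : (T : List Fm) (ψ : Fm) → Dec (InTD T ψ)
InTD? T ψ = map′ fromAny toAny (any? (λ θ → anyUpTo? (λ k → ψ ≟F diaN k θ) 4) T)
  where
  Below4 : Fm → Set
  Below4 θ = Σ ℕ λ k → k < 4 × ψ ≡ diaN k θ

  fromAny : Any Below4 T → InTD T ψ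
  fromAny a = let θ , θ∈T , k , k<4 , eq = find a in θ , θ∈T , k , s≤s⁻¹ k<4 , eq

  toAny : InTD T ψ → Any Below4 T
  toAny (θ , θ∈T , k , k≤3 , eq) = lose θ∈T (k , s≤s k≤3 , eq)

module _ (T : List Fm) where

  Der° : FStr → Fm → Set
  Der° = Der (InTC T)

  ◇-in : ∀ {θ k} → θ ∈ T → k ≤ 3 → InTD T (diaN k θ)
  ◇-in θ∈T k≤3 = _ , θ∈T , _ , k≤3 , refl

  -- T^◇ is closed under ⟨·⟩ up to derivability: ⟨χ⟩ ⇒ χ′ for some χ′ ∈ T^◇.
  -- For χ = ◇^k θ take ◇^(k+1) θ if k < 3, and ◇³θ itself (via ◇³θ ⇒ ◇²θ)
  -- if k = 3.
  wrap-step : ∀ {χ} → InTD T χ → Σ Fm λ χ′ → InTD T χ′ × Der° (wrap (fs χ)) χ′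
  wrap-step (θ , θ∈T , k , k≤3 , refl) with m≤n⇒m<n∨m≡n k≤3
  ... | inj₁ k<3  = diaN (suc k) θ , ◇-in θ∈T k<3 , diaR χ° (base (◇-in θ∈T k<3)) (ax-id χ°)
    where χ° = base (◇-in θ∈T k≤3)
  ... | inj₂ refl = diaN 3 θ , ◇-in θ∈T ≤-refl , diaR χ° χ° (ax-dia χ° (base (◇-in θ∈T (n≤1+n 2))))
    where χ° = base (◇-in θ∈T ≤-refl)

  reach : ∀ {ψ} → InTD T ψ → ∀ n → Σ Fm λ χ → InTD T χ × Der° (⟨ ψ ⟩^ n) χ
  reach {ψ} td zero    = ψ , td , ax-id (base td)
  reach     td (suc n) =
    let χ , χ◇ , ψ⇒χ = reach td n
        χ′ , χ′◇ , ⟨χ⟩⇒χ′ = wrap-step χ◇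
    in χ′ , χ′◇ , cut {n = 1} (base td) (base χ′◇) ψ⇒χ ⟨χ⟩⇒χ′

  top° : top ∈ T → InTC T top
  top° top∈T = base (◇-in {k = 0} top∈T z≤n)

  ⟦⟧⊆FS : ∀ φ Γ → ⟦ T ⟧ φ Γ → InTC T (fm Γ)
  ⟦⟧⊆FS φ Γ (inj₁ (ψ◇ , _)) = base ψ◇
  ⟦⟧⊆FS φ Γ (inj₂ (ψ° , _)) = ψ°

  FS⊆⟦top⟧ : top ∈ T → ∀ Γ → InTC T (fm Γ) → ⟦ T ⟧ top Γ
  FS⊆⟦top⟧ top∈T (⟨ ψ ⟩^ n) ψ° with InTD? T ψ
  ... | no ¬ψ◇ = inj₂ (ψ° , ¬ψ◇)
  ... | yes ψ◇ =
    let χ , χ◇ , ψ⇒χ = reach ψ◇ n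
    in inj₁ (ψ◇ , cut {n = 0} ψ° (top° top∈T) ψ⇒χ (ax-top (base χ◇) (top° top∈T)))

  Cl-extensive : ∀ X → X ⊆ Cl T X
  Cl-extensive X Γ x φ _ X⊆⟦φ⟧ = X⊆⟦φ⟧ Γ x

  Cl-least : ∀ A Y → A ⊆ Cl T Y → Cl T A ⊆ Cl T Y
  Cl-least A Y A⊆CY Γ Γ∈CA φ φ° Y⊆⟦φ⟧ = Γ∈CA φ φ° (λ Δ a → A⊆CY Δ a φ φ° Y⊆⟦φ⟧)

  -- Closing a set of structures over T° stays over T° (as [[⊤]] = FS(T°)).
  Cl-over-T° : top ∈ T → ∀ X → InFS-TC T X → InFS-TC T (Cl T X)
  Cl-over-T° top∈T X X° Γ Γ∈CX =
    ⟦⟧⊆FS top Γ (Γ∈CX top (top° top∈T) (λ Δ x → FS⊆⟦top⟧ top∈T Δ (X° Δ x)))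

lemma3p11 : (T : List Fm) → top ∈ T → bot ∈ T →
    (X Y : FSet) → InFS-TC T X → InFS-TC T Y →
    (DiaC T (Cl T X) ⊆ Cl T Y) ⇔ (Cl T X ⊆ BoxS T (Cl T Y))
lemma3p11 T top∈T _ X Y X° _ = mk⇔ forward backward
  where
  -- ⟨Γ⟩ ∈ ◇C(X) ⊆ C(◇C(X)) ⊆ C(Y), and Γ ∈ C(X) lies over T°.
  forward : DiaC T (Cl T X) ⊆ Cl T Y → Cl T X ⊆ BoxS T (Cl T Y)
  forward ◇cCX⊆CY Γ Γ∈CX =
    Cl-over-T° T top∈T X X° Γ Γ∈CX ,
    ◇cCX⊆CY (wrap Γ) (Cl-extensive T (DiaS (Cl T X)) (wrap Γ) (Γ , Γ∈CX , refl))

  -- ◇C(X) ⊆ C(Y) by hypothesis, so its closure is contained in C(Y).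
  backward : Cl T X ⊆ BoxS T (Cl T Y) → DiaC T (Cl T X) ⊆ Cl T Y
  backward CX⊆■CY = Cl-least T (DiaS (Cl T X)) Y λ { _ (Γ , Γ∈CX , refl) → proj₂ (CX⊆■CY Γ Γ∈CX) }
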